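{- Let $G$ be a simple, connected and finite graph of order $n$. Then $\alpha''(G) \leq \frac{n + \alpha(G)}{2}$.
   Context: Two vertices are adjacent if they are joined by an edge; two edges are adjacent if they share an end vertex; a vertex and an edge are adjacent if the vertex is an end vertex of the edge. $\alpha(G)$ is the maximum size of a set of pairwise non-adjacent vertices. A total independent set is a subset of $V(G)\cup E(G)$ whose elements are pairwise non-adjacent, and $\alpha''(G)$ is the maximum size of a total independent set. -}

module Defs where

import Data.Nat
import Data.Sum
import Data.Product
open import Data.Nat using (ℕ)
open import Data.Fin using (Fin; _<_)
open import Data.Fin.Subset using (Subset; _∈_; ∣_∣)
open import Data.Product using (_×_; _,_; proj₁; proj₂)
open import Data.List using (List; length)
open import Data.List.Membership.Propositional renaming (_∈_ to _∈ₗ_)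
open import Data.List.Relation.Unary.Unique.Propositional using (Unique)
open import Relation.Binary.PropositionalEquality using (_≡_)
open import Relation.Nullary using (¬_)
open import Relation.Binary using (Rel)
open import Relation.Binary.Construct.Closure.ReflexiveTransitive using (Star)
open import Level using (0ℓ)

record Graph (n : ℕ) : Set₁ where
  field
    Adj   : Rel (Fin n) 0ℓ
    sym   : ∀ {u v} → Adj u v → Adj v u
    irrefl : ∀ {u} → ¬ Adj u u

module _ {n : ℕ} (G : Graph n) where
  open Graph G

  Connected : Set
  Connected = ∀ u v → Star Adj u v

  -- An edge {u,v} is represented canonically by the ordered pair (u , v) with u < v.
  IsEdge : Fin n × Fin n → Set
  IsEdge (u , v) = (u < v) × Adj u v

  Independent : Subset n → Set
  Independent S = ∀ u v → u ∈ S → v ∈ S → ¬ Adj u v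

  IsMaximumIndependent : Subset n → Set
  IsMaximumIndependent S = Independent S × (∀ S′ → Independent S′ → ∣ S′ ∣ Data.Nat.≤ ∣ S ∣)

  Incident : Fin n → Fin n × Fin n → Set
  Incident w (u , v) = (w ≡ u) Data.Sum.⊎ (w ≡ v)

  EdgesAdjacent : Fin n × Fin n → Fin n × Fin n → Set
  EdgesAdjacent e f = Data.Product.Σ (Fin n) (λ w → Incident w e × Incident w f)

  record TotalIndependent (S : Subset n) (E : List (Fin n × Fin n)) : Set where
    field
      edges       : ∀ e → e ∈ₗ E → IsEdge e
      distinct    : Unique E
      vertsIndep  : Independent S
      vertEdge    : ∀ w e → w ∈ S → e ∈ₗ E → ¬ Incident w e
      edgesIndep  : ∀ e f → e ∈ₗ E → f ∈ₗ E → ¬ e ≡ f → ¬ EdgesAdjacent e f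

  totalSize : Subset n → List (Fin n × Fin n) → ℕ
  totalSize S E = ∣ S ∣ Data.Nat.+ length E

{-# OPTIONS --safe #-}
module Submission where

-- The vertices of S and the endpoints of the edges of E are pairwise distinct: no edge of E
-- touches S, and the edges of E form a matching. Hence |S| + 2|E| ≤ n. Since S is itself
-- independent, |S| ≤ α(G), and adding the two inequalities gives 2(|S| + |E|) ≤ n + α(G).

open import Defs
open import Data.Nat using (ℕ; _≤_; _<_; _+_; _*_; s≤s)
open import Data.Nat.Properties using (≤-trans; ≤-reflexive; +-identityʳ; +-mono-≤; +-monoˡ-≤; module ≤-Reasoning)
open import Data.Nat.Tactic.RingSolver using (solve-∀)
open import Data.Fin using (Fin)
open import Data.Fin.Properties using (<⇒≢)
open import Data.Fin.Subset using (Subset; ∣_∣; _∪_; ⁅_⁆; _∈_; _∉_)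
open import Data.Fin.Subset.Properties
  using (p⊂q⇒∣p∣<∣q∣; p⊆p∪q; q⊆p∪q; x∈⁅x⁆; x∈p∪q⁻; x∈⁅y⁆⇒x≡y; ∣p∣≤n)
open import Data.Product using (_×_; _,_)
open import Data.Sum using (_⊎_; inj₁; inj₂)
open import Data.List using (List; []; _∷_; length)
open import Data.List.Membership.Propositional using () renaming (_∈_ to _∈ₗ_)
open import Data.List.Relation.Unary.All as All using (All; []; _∷_)
open import Data.List.Relation.Unary.Any using (here; there)
open import Data.List.Relation.Unary.AllPairs using (AllPairs; []; _∷_)
open import Data.List.Relation.Unary.Unique.Propositional using (Unique)
open import Relation.Binary.PropositionalEquality using (_≡_; _≢_; refl; sym)
open import Relation.Nullary using (¬_)

Unique⇒AllPairs : ∀ {A : Set} {R : A → A → Set} {xs : List A} → Unique xs →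
                  (∀ {x y} → x ∈ₗ xs → y ∈ₗ xs → x ≢ y → R x y) → AllPairs R xs
Unique⇒AllPairs []           r = []
Unique⇒AllPairs (x∉xs ∷ xs!) r =
  All.tabulate (λ y∈xs → r (here refl) (there y∈xs) (All.lookup x∉xs y∈xs))
  ∷ Unique⇒AllPairs xs! (λ x∈xs y∈xs → r (there x∈xs) (there y∈xs))

module _ {n : ℕ} where

  x∉p⇒∣p∣<∣p∪⁅x⁆∣ : ∀ {p : Subset n} {x} → x ∉ p → ∣ p ∣ < ∣ p ∪ ⁅ x ⁆ ∣
  x∉p⇒∣p∣<∣p∪⁅x⁆∣ {p} {x} x∉p = p⊂q⇒∣p∣<∣q∣ (p⊆p∪q ⁅ x ⁆ , x , q⊆p∪q p ⁅ x ⁆ (x∈⁅x⁆ x) , x∉p)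

  x∈p∪⁅y⁆⁻ : ∀ {p : Subset n} {x y} → x ∈ p ∪ ⁅ y ⁆ → x ∈ p ⊎ x ≡ y
  x∈p∪⁅y⁆⁻ {p} {y = y} x∈ with x∈p∪q⁻ p ⁅ y ⁆ x∈
  ... | inj₁ x∈p    = inj₁ x∈p
  ... | inj₂ x∈⁅y⁆ = inj₂ (x∈⁅y⁆⇒x≡y y x∈⁅y⁆)

module _ {n : ℕ} (G : Graph n) where

  Avoids : Subset n → Fin n × Fin n → Set
  Avoids S e = ∀ w → w ∈ S → ¬ Incident G w e

  Matching : List (Fin n × Fin n) → Set
  Matching = AllPairs (λ e f → ¬ EdgesAdjacent G e f)

  avoids-∪-endpoints : ∀ {S u v f} → Avoids S f → ¬ EdgesAdjacent G (u , v) f →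
                       Avoids ((S ∪ ⁅ u ⁆) ∪ ⁅ v ⁆) f
  avoids-∪-endpoints {S} avoid e≁f w w∈ w~f with x∈p∪⁅y⁆⁻ w∈
  ... | inj₂ refl = e≁f (w , inj₂ refl , w~f)
  ... | inj₁ w∈S∪u with x∈p∪⁅y⁆⁻ {p = S} w∈S∪u
  ...   | inj₁ w∈S = avoid w w∈S w~f
  ...   | inj₂ refl = e≁f (w , inj₁ refl , w~f)

  2+∣S∣≤∣S∪endpoints∣ : ∀ {S u v} → IsEdge G (u , v) → Avoids S (u , v) →
                  2 + ∣ S ∣ ≤ ∣ (S ∪ ⁅ u ⁆) ∪ ⁅ v ⁆ ∣
  2+∣S∣≤∣S∪endpoints∣ {S} {u} {v} (u<v , _) avoid =
    ≤-trans (s≤s (x∉p⇒∣p∣<∣p∪⁅x⁆∣ u∉S)) (x∉p⇒∣p∣<∣p∪⁅x⁆∣ v∉S∪u)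
    where
    u∉S : u ∉ S
    u∉S u∈S = avoid u u∈S (inj₁ refl)
    v∉S∪u : v ∉ S ∪ ⁅ u ⁆
    v∉S∪u v∈ with x∈p∪⁅y⁆⁻ v∈
    ... | inj₁ v∈S = avoid v v∈S (inj₂ refl)
    ... | inj₂ v≡u = <⇒≢ u<v (sym v≡u)

  avoiding-matching-bound : ∀ S E → Matching E → All (IsEdge G) E → All (Avoids S) E →
                            ∣ S ∣ + 2 * length E ≤ n
  avoiding-matching-bound S [] _ _ _ = ≤-trans (≤-reflexive (+-identityʳ ∣ S ∣)) (∣p∣≤n S)
  avoiding-matching-bound S ((u , v) ∷ E) (e≁E ∷ E-matching) (e-edge ∷ E-edges) (e-avoids ∷ E-avoids) =
    begin
      ∣ S ∣ + 2 * length ((u , v) ∷ E)  ≡⟨ shift-two ∣ S ∣ (length E) ⟩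
      (2 + ∣ S ∣) + 2 * length E        ≤⟨ +-monoˡ-≤ (2 * length E) (2+∣S∣≤∣S∪endpoints∣ e-edge e-avoids) ⟩
      ∣ S′ ∣ + 2 * length E             ≤⟨ avoiding-matching-bound S′ E E-matching E-edges E-avoids-S′ ⟩
      n                                 ∎
    where
    open ≤-Reasoning
    S′ : Subset n
    S′ = (S ∪ ⁅ u ⁆) ∪ ⁅ v ⁆
    E-avoids-S′ : All (Avoids S′) E
    E-avoids-S′ = All.zipWith (λ (f-avoids , e≁f) → avoids-∪-endpoints f-avoids e≁f) (E-avoids , e≁E)
    shift-two : ∀ s m → s + 2 * (1 + m) ≡ (2 + s) + 2 * m
    shift-two = solve-∀

  totalIndependent-bound : ∀ {S E} → TotalIndependent G S E → ∣ S ∣ + 2 * length E ≤ n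
  totalIndependent-bound {S} {E} ti = avoiding-matching-bound S E
    (Unique⇒AllPairs distinct (λ e∈E f∈E → edgesIndep _ _ e∈E f∈E))
    (All.tabulate (edges _))
    (All.tabulate (λ e∈E w w∈S → vertEdge w _ w∈S e∈E))
    where open TotalIndependent ti

double-sum-bound : ∀ {a b s n} → a ≤ s → a + 2 * b ≤ n → 2 * (a + b) ≤ n + s
double-sum-bound {a} {b} a≤s a+2b≤n =
  ≤-trans (≤-reflexive (regroup a b)) (+-mono-≤ a+2b≤n a≤s)
  where
  regroup : ∀ a b → 2 * (a + b) ≡ (a + 2 * b) + a
  regroup = solve-∀

mainTheorem2 : (n : ℕ) (G : Graph n) → Connected G →
    (S₀ : Subset n) → IsMaximumIndependent G S₀ →
    (S : Subset n) (E : List (Fin n × Fin n)) → TotalIndependent G S E →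
    2 * totalSize G S E ≤ n + ∣ S₀ ∣
mainTheorem2 n G _ S₀ (_ , S₀-maximum) S E ti =
  double-sum-bound
    (S₀-maximum S (TotalIndependent.vertsIndep ti))
    (totalIndependent-bound G ti)
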